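{- Let $R_1,\dots,R_k$ be commutative rings with identity. If $\Gamma(R_i)$ is non-chordal for some $i$, then $\Gamma(R_1\times\cdots\times R_k)$ is non-chordal.
   Context: For a commutative ring $R$ with identity, the zero-divisor graph $\Gamma(R)$ is the simple undirected graph whose vertices are the nonzero zero-divisors of $R$, two distinct vertices $u,v$ being adjacent iff $uv=0$. A graph is chordal if every cycle of length greater than $3$ has a chord. -}

module Defs where

open import Level using (Level; _⊔_)
open import Data.Nat using (ℕ; zero; suc; _≤_)
open import Data.Fin using (Fin; toℕ)
open import Data.Product using (Σ; ∃; _×_; _,_)
open import Data.Sum using (_⊎_)
open import Relation.Nullary using (¬_)
open import Relation.Binary.PropositionalEquality using (_≡_; _≢_)
open import Algebra.Bundles using (CommutativeRing)
import Algebra.Construct.DirectProduct as DP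

private
  variable
    c ℓ : Level

module _ (R : CommutativeRing c ℓ) where
  open CommutativeRing R

  IsZeroDivisor : Carrier → Set (c ⊔ ℓ)
  IsZeroDivisor x = ∃ λ y → ¬ (y ≈ 0#) × (x * y ≈ 0#)

  IsVertex : Carrier → Set (c ⊔ ℓ)
  IsVertex x = ¬ (x ≈ 0#) × IsZeroDivisor x

  Adj : Carrier → Carrier → Set ℓ
  Adj u v = ¬ (u ≈ v) × (u * v ≈ 0#)

CycSucc : (m : ℕ) → Fin m → Fin m → Set
CycSucc m i j = (suc (toℕ i) ≡ toℕ j) ⊎ ((suc (toℕ i) ≡ m) × (toℕ j ≡ 0))

module _ (R : CommutativeRing c ℓ) where
  open CommutativeRing R

  record Cycle (m : ℕ) : Set (c ⊔ ℓ) where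
    field
      vtx      : Fin m → Carrier
      isVertex : ∀ i → IsVertex R (vtx i)
      distinct : ∀ i j → i ≢ j → ¬ (vtx i ≈ vtx j)
      edges    : ∀ i j → CycSucc m i j → Adj R (vtx i) (vtx j)

  HasChord : ∀ {m} → Cycle m → Set ℓ
  HasChord {m} C = ∃ λ i → ∃ λ j →
    i ≢ j × ¬ CycSucc m i j × ¬ CycSucc m j i × Adj R (vtx i) (vtx j)
    where open Cycle C

  Chordal : Set (c ⊔ ℓ)
  Chordal = ∀ (m : ℕ) → 4 ≤ m → (C : Cycle m) → HasChord C

-- Finite direct product R₀ × (R₁ × (… × Rₙ)) of n+1 commutative rings

Π-ring : (n : ℕ) → (Fin (suc n) → CommutativeRing c ℓ) → CommutativeRing c ℓ
Π-ring zero    R = R Fin.zero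
Π-ring (suc n) R = DP.commutativeRing (R Fin.zero) (Π-ring n (λ i → R (Fin.suc i)))

-- A map f : R → S that is injective, multiplicative and sends 0 to 0 carries
-- nonzero zero-divisors to nonzero zero-divisors and edges of Γ(R) to edges of
-- Γ(S), and it reflects edges. Hence a cycle of Γ(R) maps to a cycle of Γ(S) of
-- the same length, and any chord of the image pulls back to a chord of the
-- original cycle: chordality of Γ(S) descends to Γ(R). Each factor Rᵢ embeds in
-- R₁ × ⋯ × Rₖ in this way, by putting 0 in all other coordinates.
module Submission where

open import Defs
open import Level using (Level)
open import Data.Nat using (ℕ; zero; suc)
open import Data.Fin using (Fin)
open import Data.Product using (_,_; proj₁; proj₂)
open import Function.Base using (_∘_)
open import Relation.Nullary using (¬_)
open import Algebra.Bundles using (CommutativeRing)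
open import Algebra.Morphism.Structures using (module MagmaMorphisms)
import Algebra.Morphism.Construct.Composition as Composition
import Algebra.Morphism.Construct.Identity as Identity
import Algebra.Construct.DirectProduct as DP

private
  variable
    a b c ℓ ℓ₁ ℓ₂ ℓ₃ : Level

module _ (A : CommutativeRing a ℓ₁) (B : CommutativeRing b ℓ₂) where
  private
    module A = CommutativeRing A
    module B = CommutativeRing B
  open MagmaMorphisms A.*-rawMagma B.*-rawMagma

  record IsMulZeroMonomorphism (f : A.Carrier → B.Carrier) : Set (a Level.⊔ ℓ₁ Level.⊔ ℓ₂) where
    field
      *-isMagmaMonomorphism : IsMagmaMonomorphism f
      0#-homo               : f A.0# B.≈ B.0#

    open IsMagmaMonomorphism *-isMagmaMonomorphism public

module _ {A : CommutativeRing a ℓ₁} {B : CommutativeRing b ℓ₂}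
         {f : CommutativeRing.Carrier A → CommutativeRing.Carrier B}
         (mono : IsMulZeroMonomorphism A B f) where
  private
    module A = CommutativeRing A
    module B = CommutativeRing B
  open IsMulZeroMonomorphism mono

  ≉0-homo : ∀ {x} → ¬ x A.≈ A.0# → ¬ f x B.≈ B.0#
  ≉0-homo x≉0 fx≈0 = x≉0 (injective (B.trans fx≈0 (B.sym 0#-homo)))

  *≈0-homo : ∀ {x y} → x A.* y A.≈ A.0# → f x B.* f y B.≈ B.0#
  *≈0-homo {x} {y} xy≈0 = begin
    f x B.* f y  ≈⟨ homo x y ⟨
    f (x A.* y)  ≈⟨ ⟦⟧-cong xy≈0 ⟩
    f A.0#       ≈⟨ 0#-homo ⟩
    B.0#         ∎
    where open import Relation.Binary.Reasoning.Setoid B.setoid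

  *≈0-reflect : ∀ {x y} → f x B.* f y B.≈ B.0# → x A.* y A.≈ A.0#
  *≈0-reflect {x} {y} fxfy≈0 = injective (begin
    f (x A.* y)  ≈⟨ homo x y ⟩
    f x B.* f y  ≈⟨ fxfy≈0 ⟩
    B.0#         ≈⟨ 0#-homo ⟨
    f A.0#       ∎)
    where open import Relation.Binary.Reasoning.Setoid B.setoid

  isVertex-homo : ∀ {x} → IsVertex A x → IsVertex B (f x)
  isVertex-homo (x≉0 , y , y≉0 , xy≈0) = ≉0-homo x≉0 , f y , ≉0-homo y≉0 , *≈0-homo xy≈0

  adj-homo : ∀ {x y} → Adj A x y → Adj B (f x) (f y)
  adj-homo (x≉y , xy≈0) = x≉y ∘ injective , *≈0-homo xy≈0

  adj-reflect : ∀ {x y} → Adj B (f x) (f y) → Adj A x y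
  adj-reflect (fx≉fy , fxfy≈0) = fx≉fy ∘ ⟦⟧-cong , *≈0-reflect fxfy≈0

  mapCycle : ∀ {m} → Cycle A m → Cycle B m
  mapCycle C = record
    { vtx      = f ∘ vtx
    ; isVertex = isVertex-homo ∘ isVertex
    ; distinct = λ i j i≢j → distinct i j i≢j ∘ injective
    ; edges    = λ i j i→j → adj-homo (edges i j i→j)
    }
    where open Cycle C

  hasChord-reflect : ∀ {m} (C : Cycle A m) → HasChord B (mapCycle C) → HasChord A C
  hasChord-reflect C (i , j , i≢j , ¬i→j , ¬j→i , fvᵢ~fvⱼ) =
    i , j , i≢j , ¬i→j , ¬j→i , adj-reflect fvᵢ~fvⱼ

  chordal-reflect : Chordal B → Chordal A
  chordal-reflect chordalB m 4≤m C = hasChord-reflect C (chordalB m 4≤m (mapCycle C))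

id-isMulZeroMonomorphism : (A : CommutativeRing a ℓ) → IsMulZeroMonomorphism A A (λ x → x)
id-isMulZeroMonomorphism A = record
  { *-isMagmaMonomorphism = Identity.isMagmaMonomorphism *-rawMagma refl
  ; 0#-homo               = refl
  }
  where open CommutativeRing A

∘-isMulZeroMonomorphism :
  {A : CommutativeRing a ℓ₁} {B : CommutativeRing b ℓ₂} {C : CommutativeRing c ℓ₃}
  {f : CommutativeRing.Carrier A → CommutativeRing.Carrier B}
  {g : CommutativeRing.Carrier B → CommutativeRing.Carrier C} →
  IsMulZeroMonomorphism A B f → IsMulZeroMonomorphism B C g →
  IsMulZeroMonomorphism A C (g ∘ f)
∘-isMulZeroMonomorphism {C = C} {g = g} F G = record
  { *-isMagmaMonomorphism =
      Composition.isMagmaMonomorphism C.trans F.*-isMagmaMonomorphism G.*-isMagmaMonomorphism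
  ; 0#-homo = C.trans (G.⟦⟧-cong F.0#-homo) G.0#-homo
  }
  where
  module C = CommutativeRing C
  module F = IsMulZeroMonomorphism F
  module G = IsMulZeroMonomorphism G

module _ (A : CommutativeRing a ℓ₁) (B : CommutativeRing b ℓ₂) where
  private
    module A = CommutativeRing A
    module B = CommutativeRing B

  inj₁-isMulZeroMonomorphism :
    IsMulZeroMonomorphism A (DP.commutativeRing A B) (λ x → x , B.0#)
  inj₁-isMulZeroMonomorphism = record
    { *-isMagmaMonomorphism = record
      { isMagmaHomomorphism = record
        { isRelHomomorphism = record { cong = λ x≈y → x≈y , B.refl }
        ; homo              = λ _ _ → A.refl , B.sym (B.zeroˡ B.0#)
        }
      ; injective = proj₁
      }
    ; 0#-homo = A.refl , B.refl
    }

  inj₂-isMulZeroMonomorphism :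
    IsMulZeroMonomorphism B (DP.commutativeRing A B) (λ y → A.0# , y)
  inj₂-isMulZeroMonomorphism = record
    { *-isMagmaMonomorphism = record
      { isMagmaHomomorphism = record
        { isRelHomomorphism = record { cong = λ x≈y → A.refl , x≈y }
        ; homo              = λ _ _ → A.sym (A.zeroˡ A.0#) , B.refl
        }
      ; injective = proj₂
      }
    ; 0#-homo = A.refl , B.refl
    }

inject : (n : ℕ) (R : Fin (suc n) → CommutativeRing c ℓ) (i : Fin (suc n)) →
         CommutativeRing.Carrier (R i) → CommutativeRing.Carrier (Π-ring n R)
inject zero    R Fin.zero    x = x
inject (suc n) R Fin.zero    x = x , CommutativeRing.0# (Π-ring n (R ∘ Fin.suc))
inject (suc n) R (Fin.suc i) x = CommutativeRing.0# (R Fin.zero) , inject n (R ∘ Fin.suc) i x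

inject-isMulZeroMonomorphism :
  (n : ℕ) (R : Fin (suc n) → CommutativeRing c ℓ) (i : Fin (suc n)) →
  IsMulZeroMonomorphism (R i) (Π-ring n R) (inject n R i)
inject-isMulZeroMonomorphism zero    R Fin.zero    = id-isMulZeroMonomorphism (R Fin.zero)
inject-isMulZeroMonomorphism (suc n) R Fin.zero    =
  inj₁-isMulZeroMonomorphism (R Fin.zero) (Π-ring n (R ∘ Fin.suc))
inject-isMulZeroMonomorphism (suc n) R (Fin.suc i) =
  ∘-isMulZeroMonomorphism (inject-isMulZeroMonomorphism n (R ∘ Fin.suc) i)
                          (inj₂-isMulZeroMonomorphism (R Fin.zero) (Π-ring n (R ∘ Fin.suc)))

theorem3p12 : ∀ {c ℓ : Level} (n : ℕ) (R : Fin (suc n) → CommutativeRing c ℓ) (i : Fin (suc n))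
    → ¬ Chordal (R i) → ¬ Chordal (Π-ring n R)
theorem3p12 n R i ¬chordal-Rᵢ chordal-Π =
  ¬chordal-Rᵢ (chordal-reflect (inject-isMulZeroMonomorphism n R i) chordal-Π)
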